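{- Let $\mathcal{G}$ be a hereditary class of graphs that has a finite set of forbidden induced subgraphs, and let $p,q,r\ge 0$ be fixed integers. Let $\mathcal{G}'$ denote the union of the $p$-edge-add class, the $q$-edge-apex class, and the $r$-vertex-apex class of $\mathcal{G}$. Then $\mathcal{G}'$ is hereditary and has a finite set of forbidden induced subgraphs.
   Context: All graphs are simple, finite and undirected. A class of graphs is hereditary if it is closed under taking induced subgraphs; a forbidden induced subgraph for it is a graph not in the class all of whose proper induced subgraphs are in the class. A non-edge of $G$ is an edge of its complement. The $p$-edge-add class of $\mathcal{G}$ is the class of graphs from which a graph in $\mathcal{G}$ can be obtained by adding at most $p$ non-edges; the $q$-edge-apex class is the class of graphs from which a graph in $\mathcal{G}$ can be obtained by deleting at most $q$ edges; the $r$-vertex-apex class is the class of graphs from which a graph in $\mathcal{G}$ can be obtained by deleting at most $r$ vertices. -}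

module Defs where

open import Data.Nat using (ℕ; _+_; _≤_; _<_; _<ᵇ_)
open import Data.Bool using (Bool; true; false; _∧_; not; if_then_else_)
open import Data.Fin using (Fin; toℕ)
open import Data.List using (List; map; allFin)
open import Data.Nat.ListAction using (sum)
open import Data.List.Relation.Unary.Any using (Any)
open import Data.Product using (Σ; ∃; _×_; _,_)
open import Data.Sum using (_⊎_)
open import Relation.Nullary using (¬_)
open import Relation.Binary.PropositionalEquality using (_≡_)
open import Function.Definitions using (Injective; Surjective)

record SimpleAdj (n : ℕ) : Set where
  field
    adj : Fin n → Fin n → Bool
    sym : ∀ i j → adj i j ≡ adj j i
    irr : ∀ i → adj i i ≡ false
open SimpleAdj public

record Graph : Set where
  constructor mkGraph
  field
    size : ℕ
    str  : SimpleAdj size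
open Graph public

record _↪_ (H G : Graph) : Set where
  field
    emb      : Fin (size H) → Fin (size G)
    injective : Injective _≡_ _≡_ emb
    preserves : ∀ i j → adj (str G) (emb i) (emb j) ≡ adj (str H) i j
open _↪_ public

_≅_ : Graph → Graph → Set
H ≅ G = Σ (H ↪ G) λ e → Surjective _≡_ _≡_ (_↪_.emb e)

Class : Set₁
Class = Graph → Set

Hereditary : Class → Set
Hereditary 𝒢 = ∀ G H → H ↪ G → 𝒢 G → 𝒢 H

Forbidden : Class → Graph → Set
Forbidden 𝒢 F = ¬ 𝒢 F × (∀ H → H ↪ F → size H < size F → 𝒢 H)

HasFiniteForbidden : Class → Set
HasFiniteForbidden 𝒢 =
  ∃ λ (L : List Graph) → ∀ F → Forbidden 𝒢 F → Any (λ F′ → F ≅ F′) L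

_⊆E_ : ∀ {n} → SimpleAdj n → SimpleAdj n → Set
A ⊆E B = ∀ i j → adj A i j ≡ true → adj B i j ≡ true

edgeDiff : ∀ {n} → SimpleAdj n → SimpleAdj n → ℕ
edgeDiff {n} A B =
  sum (map (λ i → sum (map (λ j →
    if (toℕ i <ᵇ toℕ j) ∧ adj B i j ∧ not (adj A i j) then 1 else 0)
    (allFin n))) (allFin n))

EdgeAdd : ℕ → Class → Class
EdgeAdd p 𝒢 (mkGraph n A) =
  ∃ λ (B : SimpleAdj n) → A ⊆E B × edgeDiff A B ≤ p × 𝒢 (mkGraph n B)

EdgeApex : ℕ → Class → Class
EdgeApex q 𝒢 (mkGraph n A) =
  ∃ λ (B : SimpleAdj n) → B ⊆E A × edgeDiff B A ≤ q × 𝒢 (mkGraph n B)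

VertexApex : ℕ → Class → Class
VertexApex r 𝒢 G =
  ∃ λ (H : Graph) → H ↪ G × size G ≤ size H + r × 𝒢 H

UnionClass : ℕ → ℕ → ℕ → Class → Class
UnionClass p q r 𝒢 G = EdgeAdd p 𝒢 G ⊎ EdgeApex q 𝒢 G ⊎ VertexApex r 𝒢 G

-- A class 𝒢 is locally determined with bound N if every graph outside 𝒢 has a set of
-- at most N vertices inducing a graph outside 𝒢. For a hereditary class this amounts to
-- having finitely many forbidden induced subgraphs: a minimal induced non-member is
-- forbidden, hence small; conversely every forbidden graph has at most N vertices, so it
-- occurs in the finite list of all graphs on at most N vertices. Unions preserve local
-- determination, so the three classes can be treated one at a time.
--
-- If G is not in the p-edge-add class, let W₀ witness G ∉ 𝒢. Every way of adding at
-- most p non-edges that lands in 𝒢 adds some non-edge uv inside W₀, and G + uv is not in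
-- the (p - 1)-edge-add class, so by induction it has a small witness W_uv; then W₀ together
-- with all the W_uv witnesses G. The q-edge-apex class is the edge-add class of the
-- complements, and the r-vertex-apex class is handled like the edge-add class, deleting a
-- vertex v ∈ W₀ instead of adding a non-edge.

module Submission where

open import Defs renaming (sym to adj-sym; irr to adj-irr)
open import Data.Nat using (ℕ; zero; suc; _+_; _*_; _^_; _∸_; _≤_; _<_; z≤n; s≤s; _<ᵇ_; _<?_; _≤?_)
open import Data.Nat.Induction using (<-wellFounded)
open import Induction.WellFounded using (Acc; acc)
open import Data.Nat.Properties hiding (_≟_)
open import Data.Bool using (Bool; true; false; _∧_; _∨_; not; if_then_else_)
import Data.Bool as Bool
open import Data.Bool.Properties
  using (not-involutive; ∧-comm; ∧-idem; ∧-zeroʳ; ∧-identityʳ; ∧-inverseʳ; ∨-comm; ∨-identityʳ; T-≡; ¬-not)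
open import Data.Fin using (Fin; zero; suc; toℕ; punchIn; punchOut; _≟_; finToFun; funToFin)
import Data.Fin.Properties as Fin
open import Data.Fin.Properties using (punchInᵢ≢i; punchIn-punchOut; punchOut-injective; ¬Fin0; finToFun-funToFin)
open import Data.Fin.Subset
open import Data.Fin.Subset.Properties
open import Data.List as List using (List; _∷_; allFin)
open import Data.List.Relation.Unary.Any using (Any; here; there)
import Data.List.Relation.Unary.Any.Properties as Any
open import Data.List.Membership.Propositional using (lose)
open import Data.List.Membership.Propositional.Properties using (∈-allFin)
open import Data.List.Properties using (map-tabulate)
import Data.Nat.ListAction as ListAction
open import Data.Maybe as Maybe using (Maybe; just; nothing)
open import Data.Vec as Vec using (_∷_; []; here; there)
open import Data.Vec.Functional using (removeAt)
open import Data.Product as Product using (∃; _×_; _,_; proj₁; proj₂)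
open import Data.Sum using (_⊎_; inj₁; inj₂; [_,_]′)
open import Data.Empty using (⊥-elim)
open import Function using (_∘_; id)
open import Function.Definitions using (Injective)
open import Level using (0ℓ)
open import Effect.Monad using (RawMonad)
open import Relation.Nullary using (¬_; Dec; yes; no; does; contradiction)
open import Relation.Nullary.Decidable using (dec-true; dec-false; does-⇔)
open import Function.Bundles using (mk⇔; Equivalence)
open import Relation.Nullary.Negation using (¬¬-Monad)
open import Relation.Unary using (Decidable)
open import Relation.Binary using (tri<; tri≈; tri>)
open import Relation.Binary.PropositionalEquality
  using (_≡_; _≢_; refl; sym; trans; cong; cong₂; subst; module ≡-Reasoning)
open import Algebra.Properties.CommutativeMonoid.Sum +-0-commutativeMonoid
  using (sum; sum-syntax; sum-cong-≗; sum-remove; sum-replicate-zero; ∑-distrib-+; ∑-comm)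

open RawMonad (¬¬-Monad {a = 0ℓ}) using (_>>=_; pure)

𝟙 : Bool → ℕ
𝟙 b = if b then 1 else 0

sum-tabulate : ∀ {n} (f : Fin n → ℕ) → ListAction.sum (List.tabulate f) ≡ ∑[ i < n ] f i
sum-tabulate {zero}  f = refl
sum-tabulate {suc n} f = cong (f zero +_) (sum-tabulate (f ∘ suc))

sum-map-allFin : ∀ n (f : Fin n → ℕ) → ListAction.sum (List.map f (allFin n)) ≡ ∑[ i < n ] f i
sum-map-allFin n f = trans (cong ListAction.sum (map-tabulate id f)) (sum-tabulate f)

∑-mono-≤ : ∀ {n} {f g : Fin n → ℕ} → (∀ i → f i ≤ g i) → ∑[ i < n ] f i ≤ ∑[ i < n ] g i
∑-mono-≤ {zero}  f≤g = z≤n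
∑-mono-≤ {suc n} f≤g = +-mono-≤ (f≤g zero) (∑-mono-≤ (f≤g ∘ suc))

∑-zero : ∀ {n} {f : Fin n → ℕ} → (∀ i → f i ≡ 0) → ∑[ i < n ] f i ≡ 0
∑-zero {n} f≡0 = trans (sum-cong-≗ f≡0) (sum-replicate-zero n)

∑-pointMass : ∀ {n} {f : Fin n → ℕ} (v : Fin n) → (∀ i → i ≢ v → f i ≡ 0) → ∑[ i < n ] f i ≡ f v
∑-pointMass {suc n} {f} v f≡0 = begin
  sum f                     ≡⟨ sum-remove {i = v} f ⟩
  f v + sum (removeAt f v)  ≡⟨ cong (f v +_) (∑-zero λ j → f≡0 (punchIn v j) (punchInᵢ≢i v j)) ⟩
  f v + 0                   ≡⟨ +-identityʳ (f v) ⟩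
  f v                       ∎
  where open ≡-Reasoning

∑-injective-≤ : ∀ {m n} {e : Fin m → Fin n} → Injective _≡_ _≡_ e →
                (f : Fin n → ℕ) → ∑[ i < m ] f (e i) ≤ ∑[ j < n ] f j
∑-injective-≤ {zero}          _   f = z≤n
∑-injective-≤ {suc m} {zero}  {e} _ f = contradiction (e zero) ¬Fin0
∑-injective-≤ {suc m} {suc n} {e} inj f = begin
  f e₀ + ∑[ i < m ] f (e (suc i))             ≡⟨ cong (f e₀ +_) (sum-cong-≗ λ i →
                                                   cong f (sym (punchIn-punchOut (e₀≢ i)))) ⟩
  f e₀ + ∑[ i < m ] removeAt f e₀ (e′ i)      ≤⟨ +-monoʳ-≤ (f e₀) (∑-injective-≤ e′-injective _) ⟩
  f e₀ + sum (removeAt f e₀)                  ≡⟨ sum-remove {i = e₀} f ⟨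
  sum f                                       ∎
  where
  open ≤-Reasoning
  e₀ : Fin (suc n)
  e₀ = e zero
  e₀≢ : ∀ i → e₀ ≢ e (suc i)
  e₀≢ i = Fin.0≢1+n ∘ inj
  e′ : Fin m → Fin n
  e′ i = punchOut (e₀≢ i)
  e′-injective : Injective _≡_ _≡_ e′
  e′-injective eq = Fin.suc-injective (inj (punchOut-injective (e₀≢ _) (e₀≢ _) eq))

-- Finite choice under double negation

∀¬¬⇒¬¬∀ : ∀ {n} {P : Fin n → Set} → (∀ i → ¬ ¬ P i) → ¬ ¬ (∀ i → P i)
∀¬¬⇒¬¬∀ {zero}  _ = pure λ ()
∀¬¬⇒¬¬∀ {suc n} h = do
  p₀ ← h zero
  ps ← ∀¬¬⇒¬¬∀ (h ∘ suc)
  pure λ { zero → p₀ ; (suc i) → ps i }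

∀¬¬⇒¬¬∀-Subset : ∀ {n} {P : Subset n → Set} → (∀ p → ¬ ¬ P p) → ¬ ¬ (∀ p → P p)
∀¬¬⇒¬¬∀-Subset {zero}  h = do
  p ← h []
  pure λ { [] → p }
∀¬¬⇒¬¬∀-Subset {suc n} h = do
  pᵢ ← ∀¬¬⇒¬¬∀-Subset (h ∘ (inside ∷_))
  pₒ ← ∀¬¬⇒¬¬∀-Subset (h ∘ (outside ∷_))
  pure λ { (inside ∷ p) → pᵢ p ; (outside ∷ p) → pₒ p }

enum : ∀ {n} (p : Subset n) → Fin ∣ p ∣ → Fin n
enum (inside  ∷ p) zero    = zero
enum (inside  ∷ p) (suc k) = suc (enum p k)
enum (outside ∷ p) k       = suc (enum p k)

enum-∈ : ∀ {n} (p : Subset n) k → enum p k ∈ p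
enum-∈ (inside  ∷ p) zero    = here
enum-∈ (inside  ∷ p) (suc k) = there (enum-∈ p k)
enum-∈ (outside ∷ p) k       = there (enum-∈ p k)

enum-injective : ∀ {n} (p : Subset n) → Injective _≡_ _≡_ (enum p)
enum-injective (inside  ∷ p) {zero}  {zero}  _  = refl
enum-injective (inside  ∷ p) {suc k} {suc l} eq = cong suc (enum-injective p (Fin.suc-injective eq))
enum-injective (outside ∷ p)                 eq = enum-injective p (Fin.suc-injective eq)

∈⇒enum : ∀ {n} {p : Subset n} {x} → x ∈ p → ∃ λ k → enum p k ≡ x
∈⇒enum {p = inside  ∷ p} here        = zero , refl
∈⇒enum {p = inside  ∷ p} (there x∈p) = Product.map suc (cong suc) (∈⇒enum x∈p)
∈⇒enum {p = outside ∷ p} (there x∈p) = Product.map₂ (cong suc) (∈⇒enum x∈p)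

∑-support : ∀ {n} (p : Subset n) {f : Fin n → ℕ} → (∀ i → i ∉ p → f i ≡ 0) →
            ∑[ i < n ] f i ≡ ∑[ k < ∣ p ∣ ] f (enum p k)
∑-support []            _   = refl
∑-support (inside  ∷ p) {f} f≡0 = cong (f zero +_) (∑-support p λ i i∉p → f≡0 (suc i) (i∉p ∘ drop-there))
∑-support (outside ∷ p) f≡0 = cong₂ _+_ (f≡0 zero λ ()) (∑-support p λ i i∉p → f≡0 (suc i) (i∉p ∘ drop-there))

position : ∀ {n} (p : Subset n) → Fin n → Maybe (Fin ∣ p ∣)
position (inside  ∷ p) zero    = just zero
position (inside  ∷ p) (suc i) = Maybe.map suc (position p i)
position (outside ∷ p) zero    = nothing
position (outside ∷ p) (suc i) = position p i

position-enum : ∀ {n} (p : Subset n) k → position p (enum p k) ≡ just k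
position-enum (inside  ∷ p) zero    = refl
position-enum (inside  ∷ p) (suc k) = cong (Maybe.map suc) (position-enum p k)
position-enum (outside ∷ p) k       = position-enum p k

position-just : ∀ {n} (p : Subset n) i {k} → position p i ≡ just k → enum p k ≡ i
position-just (inside  ∷ p) zero    refl = refl
position-just (inside  ∷ p) (suc i) eq with position p i in eq′
... | just k with refl ← eq = cong suc (position-just p i eq′)
position-just (outside ∷ p) (suc i) eq = cong suc (position-just p i eq)

position-∉ : ∀ {n} {p : Subset n} {i} → i ∉ p → position p i ≡ nothing
position-∉ {p = inside  ∷ p} {zero}  i∉p = contradiction here i∉p
position-∉ {p = inside  ∷ p} {suc i} i∉p = cong (Maybe.map suc) (position-∉ (i∉p ∘ there))
position-∉ {p = outside ∷ p} {zero}  i∉p = refl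
position-∉ {p = outside ∷ p} {suc i} i∉p = position-∉ (i∉p ∘ there)

select : ∀ {n} {P : Fin n → Set} → Decidable P → Subset n
select P? = Vec.tabulate (does ∘ P?)

∈-select⁺ : ∀ {n} {P : Fin n → Set} (P? : Decidable P) {i} → P i → i ∈ select P?
∈-select⁺ {suc n} P? {zero} Pi with P? zero
... | yes _   = here
... | no ¬Pi  = contradiction Pi ¬Pi
∈-select⁺ {suc n} P? {suc i} Pi = there (∈-select⁺ (P? ∘ suc) Pi)

∈-select⁻ : ∀ {n} {P : Fin n → Set} (P? : Decidable P) {i} → i ∈ select P? → P i
∈-select⁻ {suc n} P? {zero} i∈ with P? zero | i∈
... | yes Pi | _ = Pi
∈-select⁻ {suc n} P? {suc i} (there i∈) = ∈-select⁻ (P? ∘ suc) i∈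

image : ∀ {m n} → (Fin m → Fin n) → Subset n
image f = select λ y → Fin.any? λ x → f x ≟ y

image-∈ : ∀ {m n} (f : Fin m → Fin n) x → f x ∈ image f
image-∈ f x = ∈-select⁺ (λ y → Fin.any? λ x → f x ≟ y) (x , refl)

∈-image : ∀ {m n} (f : Fin m → Fin n) {y} → y ∈ image f → ∃ λ x → f x ≡ y
∈-image f = ∈-select⁻ λ y → Fin.any? λ x → f x ≟ y

x∈p─q⇒x∉q : ∀ {n} {p q : Subset n} {x} → x ∈ p ─ q → x ∉ q
x∈p─q⇒x∉q {p = s ∷ p} {inside  ∷ q} ()          here
x∈p─q⇒x∉q {p = s ∷ p} {t       ∷ q} (there x∈) (there x∈q) = x∈p─q⇒x∉q x∈ x∈q

∣p─q∣+∣p∩q∣≡∣p∣ : ∀ {n} (p q : Subset n) → ∣ p ─ q ∣ + ∣ p ∩ q ∣ ≡ ∣ p ∣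
∣p─q∣+∣p∩q∣≡∣p∣ []            []            = refl
∣p─q∣+∣p∩q∣≡∣p∣ (inside  ∷ p) (inside  ∷ q) = trans (+-suc _ _) (cong suc (∣p─q∣+∣p∩q∣≡∣p∣ p q))
∣p─q∣+∣p∩q∣≡∣p∣ (inside  ∷ p) (outside ∷ q) = cong suc (∣p─q∣+∣p∩q∣≡∣p∣ p q)
∣p─q∣+∣p∩q∣≡∣p∣ (outside ∷ p) (inside  ∷ q) = ∣p─q∣+∣p∩q∣≡∣p∣ p q
∣p─q∣+∣p∩q∣≡∣p∣ (outside ∷ p) (outside ∷ q) = ∣p─q∣+∣p∩q∣≡∣p∣ p q

∣p∣≤∣p─q∣+∣q∣ : ∀ {n} (p q : Subset n) → ∣ p ∣ ≤ ∣ p ─ q ∣ + ∣ q ∣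
∣p∣≤∣p─q∣+∣q∣ p q = begin
  ∣ p ∣                  ≡⟨ ∣p─q∣+∣p∩q∣≡∣p∣ p q ⟨
  ∣ p ─ q ∣ + ∣ p ∩ q ∣  ≤⟨ +-monoʳ-≤ ∣ p ─ q ∣ (∣p∩q∣≤∣q∣ p q) ⟩
  ∣ p ─ q ∣ + ∣ q ∣      ∎
  where open ≤-Reasoning

q⊆p⇒∣p─q∣+∣q∣≤∣p∣ : ∀ {n} {p q : Subset n} → q ⊆ p → ∣ p ─ q ∣ + ∣ q ∣ ≤ ∣ p ∣
q⊆p⇒∣p─q∣+∣q∣≤∣p∣ {p = p} {q} q⊆p = begin
  ∣ p ─ q ∣ + ∣ q ∣      ≤⟨ +-monoʳ-≤ ∣ p ─ q ∣ (p⊆q⇒∣p∣≤∣q∣ λ x∈q → x∈p∩q⁺ (q⊆p x∈q , x∈q)) ⟩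
  ∣ p ─ q ∣ + ∣ p ∩ q ∣  ≡⟨ ∣p─q∣+∣p∩q∣≡∣p∣ p q ⟩
  ∣ p ∣                  ∎
  where open ≤-Reasoning

∣p∪q∣≤∣p∣+∣q∣ : ∀ {n} (p q : Subset n) → ∣ p ∪ q ∣ ≤ ∣ p ∣ + ∣ q ∣
∣p∪q∣≤∣p∣+∣q∣ []            []            = z≤n
∣p∪q∣≤∣p∣+∣q∣ (inside  ∷ p) (s       ∷ q) =
  s≤s (≤-trans (∣p∪q∣≤∣p∣+∣q∣ p q) (+-monoʳ-≤ ∣ p ∣ (∣p∣≤∣x∷p∣ s q)))
∣p∪q∣≤∣p∣+∣q∣ (outside ∷ p) (inside  ∷ q) =
  ≤-trans (s≤s (∣p∪q∣≤∣p∣+∣q∣ p q)) (≤-reflexive (sym (+-suc ∣ p ∣ ∣ q ∣)))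
∣p∪q∣≤∣p∣+∣q∣ (outside ∷ p) (outside ∷ q) = ∣p∪q∣≤∣p∣+∣q∣ p q

injective⇒∣p∣≤∣q∣ : ∀ {m n} {e : Fin m → Fin n} → Injective _≡_ _≡_ e →
                    {p : Subset m} {q : Subset n} → (∀ {x} → x ∈ p → e x ∈ q) → ∣ p ∣ ≤ ∣ q ∣
injective⇒∣p∣≤∣q∣ {e = e} inj {p} {q} e[p]⊆q = Fin.injective⇒≤ {f = e′} e′-injective
  where
  e′ : Fin ∣ p ∣ → Fin ∣ q ∣
  e′ k = proj₁ (∈⇒enum (e[p]⊆q (enum-∈ p k)))
  e′-injective : Injective _≡_ _≡_ e′
  e′-injective {k} {l} eq = enum-injective p (inj (begin
    e (enum p k)   ≡⟨ proj₂ (∈⇒enum (e[p]⊆q (enum-∈ p k))) ⟨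
    enum q (e′ k)  ≡⟨ cong (enum q) eq ⟩
    enum q (e′ l)  ≡⟨ proj₂ (∈⇒enum (e[p]⊆q (enum-∈ p l))) ⟩
    e (enum p l)   ∎))
    where open ≡-Reasoning

∣⊥∣≤m : ∀ {n m} → ∣ ⊥ {n} ∣ ≤ m
∣⊥∣≤m {n} {m} = subst (_≤ m) (sym (∣⊥∣≡0 n)) z≤n

⋃ᶠ : ∀ {m n} → (Fin m → Subset n) → Subset n
⋃ᶠ f = ⋃ (List.tabulate f)

fk⊆⋃ᶠf : ∀ {m n} (f : Fin m → Subset n) k → f k ⊆ ⋃ᶠ f
fk⊆⋃ᶠf f zero    = p⊆p∪q _
fk⊆⋃ᶠf f (suc k) = q⊆p∪q (f zero) _ ∘ fk⊆⋃ᶠf (f ∘ suc) k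

⋃ᶠ-least : ∀ {m n} {f : Fin m → Subset n} {q} → (∀ k → f k ⊆ q) → ⋃ᶠ f ⊆ q
⋃ᶠ-least {zero}          fk⊆q x∈ = contradiction x∈ ∉⊥
⋃ᶠ-least {suc m} {f = f} fk⊆q x∈ with x∈p∪q⁻ (f zero) _ x∈
... | inj₁ x∈f₀ = fk⊆q zero x∈f₀
... | inj₂ x∈⋃  = ⋃ᶠ-least (fk⊆q ∘ suc) x∈⋃

∣⋃ᶠf∣≤m*N : ∀ {m n N} (f : Fin m → Subset n) → (∀ k → ∣ f k ∣ ≤ N) → ∣ ⋃ᶠ f ∣ ≤ m * N
∣⋃ᶠf∣≤m*N {zero}  {n} f _   = ≤-reflexive (∣⊥∣≡0 n)
∣⋃ᶠf∣≤m*N {suc m}     f ∣fk∣≤N =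
  ≤-trans (∣p∪q∣≤∣p∣+∣q∣ (f zero) _) (+-mono-≤ (∣fk∣≤N zero) (∣⋃ᶠf∣≤m*N (f ∘ suc) (∣fk∣≤N ∘ suc)))

restrict : ∀ {m n} → SimpleAdj n → (Fin m → Fin n) → SimpleAdj m
restrict A e = record
  { adj = λ i j → adj A (e i) (e j)
  ; sym = λ i j → adj-sym A (e i) (e j)
  ; irr = λ i → adj-irr A (e i)
  }

infix 25 _[_]
_[_] : (G : Graph) → Subset (size G) → Graph
G [ p ] = mkGraph ∣ p ∣ (restrict (str G) (enum p))

↪-size : ∀ {H G} → H ↪ G → size H ≤ size G
↪-size e = Fin.injective⇒≤ (injective e)

↪-trans : ∀ {K H G} → K ↪ H → H ↪ G → K ↪ G
↪-trans f e = record
  { emb       = emb e ∘ emb f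
  ; injective = injective f ∘ injective e
  ; preserves = λ i j → trans (preserves e (emb f i) (emb f j)) (preserves f i j)
  }

factor : ∀ {G H K} (e : H ↪ G) (f : K ↪ G) → (∀ y → ∃ λ x → emb e x ≡ emb f y) → K ↪ H
factor {G} {H} {K} e f lift = record
  { emb       = emb′
  ; injective = λ {x} {y} eq → injective f (begin
      emb f x         ≡⟨ proj₂ (lift x) ⟨
      emb e (emb′ x)  ≡⟨ cong (emb e) eq ⟩
      emb e (emb′ y)  ≡⟨ proj₂ (lift y) ⟩
      emb f y         ∎)
  ; preserves = λ i j → begin
      adj (str H) (emb′ i) (emb′ j)                  ≡⟨ preserves e (emb′ i) (emb′ j) ⟨
      adj (str G) (emb e (emb′ i)) (emb e (emb′ j))  ≡⟨ cong₂ (adj (str G)) (proj₂ (lift i)) (proj₂ (lift j)) ⟩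
      adj (str G) (emb f i) (emb f j)                ≡⟨ preserves f i j ⟩
      adj (str K) i j                                ∎
  }
  where
  open ≡-Reasoning
  emb′ : Fin (size K) → Fin (size H)
  emb′ = proj₁ ∘ lift

restrict-↪ : ∀ {m n} {e : Fin m → Fin n} (B : SimpleAdj n) → Injective _≡_ _≡_ e →
             mkGraph m (restrict B e) ↪ mkGraph n B
restrict-↪ {e = e} B inj = record { emb = e ; injective = inj ; preserves = λ _ _ → refl }

[]↪ : ∀ G (p : Subset (size G)) → G [ p ] ↪ G
[]↪ G p = restrict-↪ (str G) (enum-injective p)

≗⇒↪ : ∀ {n} {A B : SimpleAdj n} → (∀ i j → adj B i j ≡ adj A i j) → mkGraph n A ↪ mkGraph n B
≗⇒↪ B≗A = record { emb = id ; injective = id ; preserves = B≗A }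

↪-refl : ∀ {G} → G ↪ G
↪-refl = ≗⇒↪ λ _ _ → refl

↪[⊤] : ∀ G → G ↪ G [ ⊤ ]
↪[⊤] G = factor ([]↪ G ⊤) ↪-refl λ x → ∈⇒enum ∈⊤

⊆⇒[]↪[] : ∀ G {p q : Subset (size G)} → p ⊆ q → G [ p ] ↪ G [ q ]
⊆⇒[]↪[] G {p} {q} p⊆q = factor ([]↪ G q) ([]↪ G p) (λ k → ∈⇒enum (p⊆q (enum-∈ p k)))

↪[image] : ∀ {H G} (e : H ↪ G) → H ↪ G [ image (emb e) ]
↪[image] {G = G} e = factor ([]↪ G _) e λ x → ∈⇒enum (image-∈ (emb e) x)

[image]↪ : ∀ {H G} (e : H ↪ G) → G [ image (emb e) ] ↪ H
[image]↪ {G = G} e = factor e ([]↪ G _) λ k → ∈-image (emb e) (enum-∈ (image (emb e)) k)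


-- Locally determined classes

-- Membership in a class need not be decidable, so the small witness is only
-- claimed under double negation.
LocallyDetermined : ℕ → Class → Set
LocallyDetermined N 𝒢 = ∀ G → ¬ 𝒢 G → ¬ ¬ ∃ λ (W : Subset (size G)) → ∣ W ∣ ≤ N × ¬ 𝒢 (G [ W ])

∉-mono : ∀ {𝒢 : Class} → Hereditary 𝒢 → ∀ G {p q : Subset (size G)} → p ⊆ q →
         ¬ 𝒢 (G [ p ]) → ¬ 𝒢 (G [ q ])
∉-mono her G p⊆q p∉ q∈ = p∉ (her _ _ (⊆⇒[]↪[] G p⊆q) q∈)

witness-within : ∀ {𝒢 : Class} {N} → Hereditary 𝒢 → LocallyDetermined N 𝒢 →
                 ∀ G (U : Subset (size G)) → ¬ 𝒢 (G [ U ]) →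
                 ¬ ¬ ∃ λ W → W ⊆ U × ∣ W ∣ ≤ N × ¬ 𝒢 (G [ W ])
witness-within her local G U U∉ = do
  (W , ∣W∣≤N , W∉) ← local (G [ U ]) U∉
  let e : G [ U ] [ W ] ↪ G
      e = ↪-trans ([]↪ (G [ U ]) W) ([]↪ G U)
  pure ( image (emb e)
       , (λ {x} x∈ → subst (_∈ U) (proj₂ (∈-image (emb e) x∈)) (enum-∈ U _))
       , ≤-trans (↪-size ([image]↪ e)) ∣W∣≤N
       , λ T∈ → W∉ (her _ _ (↪[image] e) T∈) )

_∪ᶜ_ : Class → Class → Class
(𝒜 ∪ᶜ ℬ) G = 𝒜 G ⊎ ℬ G

∪ᶜ-hereditary : ∀ {𝒜 ℬ} → Hereditary 𝒜 → Hereditary ℬ → Hereditary (𝒜 ∪ᶜ ℬ)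
∪ᶜ-hereditary her𝒜 herℬ G H e (inj₁ G∈) = inj₁ (her𝒜 G H e G∈)
∪ᶜ-hereditary her𝒜 herℬ G H e (inj₂ G∈) = inj₂ (herℬ G H e G∈)

∪ᶜ-locallyDetermined : ∀ {𝒜 ℬ M N} → Hereditary 𝒜 → Hereditary ℬ →
                       LocallyDetermined M 𝒜 → LocallyDetermined N ℬ → LocallyDetermined (M + N) (𝒜 ∪ᶜ ℬ)
∪ᶜ-locallyDetermined her𝒜 herℬ local𝒜 localℬ G G∉ = do
  (U , ∣U∣≤M , U∉) ← local𝒜 G (G∉ ∘ inj₁)
  (V , ∣V∣≤N , V∉) ← localℬ G (G∉ ∘ inj₂)
  pure ( U ∪ V
       , ≤-trans (∣p∪q∣≤∣p∣+∣q∣ U V) (+-mono-≤ ∣U∣≤M ∣V∣≤N)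
       , λ { (inj₁ ∈𝒜) → ∉-mono her𝒜 G (p⊆p∪q V) U∉ ∈𝒜
           ; (inj₂ ∈ℬ) → ∉-mono herℬ G (q⊆p∪q U V) V∉ ∈ℬ } )

module _ {𝒢 : Class} (her : Hereditary 𝒢) (G : Graph) where

  -- Either some smaller T induces a non-member, and we recurse on it, or G [ S ] is
  -- forbidden; double negation provides this case split for all T simultaneously.
  forbidden-induced : ∀ (S : Subset (size G)) → Acc _<_ ∣ S ∣ → ¬ 𝒢 (G [ S ]) →
                      ¬ ¬ ∃ λ W → Forbidden 𝒢 (G [ W ])
  forbidden-induced S (acc rec) S∉ noForbidden =
    ∀¬¬⇒¬¬∀-Subset smaller-∈ λ smaller∈ → noForbidden (S , S∉ , λ H e size<  →
      let e′ : H ↪ G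
          e′ = ↪-trans e ([]↪ G S) in
      her _ _ (↪[image] e′) (smaller∈ _ (≤-<-trans (↪-size ([image]↪ e′)) size<)))
    where
    smaller-∈ : ∀ T → ¬ ¬ (∣ T ∣ < ∣ S ∣ → 𝒢 (G [ T ]))
    smaller-∈ T ¬P with ∣ T ∣ <? ∣ S ∣
    ... | no  ∣T∣≮∣S∣ = ¬P λ ∣T∣<∣S∣ → contradiction ∣T∣<∣S∣ ∣T∣≮∣S∣
    ... | yes ∣T∣<∣S∣ = forbidden-induced T (rec ∣T∣<∣S∣) (λ T∈ → ¬P λ _ → T∈) noForbidden

sizeBound : List Graph → ℕ
sizeBound = ListAction.sum ∘ List.map size

≅-∈⇒size≤ : ∀ {F} (L : List Graph) → Any (F ≅_) L → size F ≤ sizeBound L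
≅-∈⇒size≤ (F′ ∷ L) (here (e , _)) = ≤-trans (↪-size e) (m≤m+n (size F′) (sizeBound L))
≅-∈⇒size≤ (F′ ∷ L) (there F∈L)    = ≤-trans (≅-∈⇒size≤ L F∈L) (m≤n+m (sizeBound L) (size F′))

hasFiniteForbidden⇒locallyDetermined : ∀ {𝒢} → Hereditary 𝒢 → ((L , _) : HasFiniteForbidden 𝒢) →
                                       LocallyDetermined (sizeBound L) 𝒢
hasFiniteForbidden⇒locallyDetermined her (L , complete) G G∉ = do
  (W , W-forbidden) ← forbidden-induced her G ⊤ (<-wellFounded _) (G∉ ∘ her _ _ (↪[⊤] G))
  pure (W , ≅-∈⇒size≤ L (complete _ W-forbidden) , proj₁ W-forbidden)

bit : Fin 2 → Bool
bit zero    = false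
bit (suc _) = true

toBit : Bool → Fin 2
toBit false = zero
toBit true  = suc zero

bit-toBit : ∀ b → bit (toBit b) ≡ b
bit-toBit false = refl
bit-toBit true  = refl

-- A code is read as n rows of n bits; symmetrize makes any such matrix a simple graph.
decode : ∀ {n} → Fin ((2 ^ n) ^ n) → Fin n → Fin n → Bool
decode c i j = bit (finToFun (finToFun c i) j)

encode : ∀ {n} → (Fin n → Fin n → Bool) → Fin ((2 ^ n) ^ n)
encode f = funToFin λ i → funToFin λ j → toBit (f i j)

decode-encode : ∀ {n} (f : Fin n → Fin n → Bool) i j → decode (encode f) i j ≡ f i j
decode-encode f i j = begin
  bit (finToFun (finToFun (encode f) i) j)                      ≡⟨ cong (λ r → bit (finToFun r j)) (finToFun-funToFin _ i) ⟩
  bit (finToFun (funToFin λ j → toBit (f i j)) j)               ≡⟨ cong bit (finToFun-funToFin _ j) ⟩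
  bit (toBit (f i j))                                           ≡⟨ bit-toBit (f i j) ⟩
  f i j                                                         ∎
  where open ≡-Reasoning

≟-sym : ∀ {n} (i j : Fin n) → does (i ≟ j) ≡ does (j ≟ i)
≟-sym i j = does-⇔ (mk⇔ sym sym) (i ≟ j) (j ≟ i)

symmetrize : ∀ {n} → (Fin n → Fin n → Bool) → SimpleAdj n
symmetrize f = record
  { adj = λ i j → not (does (i ≟ j)) ∧ f i j ∧ f j i
  ; sym = λ i j → cong₂ (λ d e → not d ∧ e) (≟-sym i j) (∧-comm (f i j) (f j i))
  ; irr = λ i → cong (λ d → not d ∧ f i i ∧ f i i) (dec-true (i ≟ i) refl)
  }

symmetrize-adj : ∀ {n} (A : SimpleAdj n) i j → adj (symmetrize (adj A)) i j ≡ adj A i j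
symmetrize-adj A i j with i ≟ j
... | yes refl = sym (adj-irr A i)
... | no  _    = trans (cong (adj A i j ∧_) (adj-sym A j i)) (∧-idem (adj A i j))

graphsOfSize : ℕ → List Graph
graphsOfSize n = List.map (λ c → mkGraph n (symmetrize (decode c))) (allFin _)

graphsOfSize-complete : ∀ F → Any (F ≅_) (graphsOfSize (size F))
graphsOfSize-complete F = Any.map⁺ (lose (∈-allFin (encode (adj (str F)))) (iso , λ y → y , id))
  where
  iso : F ↪ mkGraph (size F) (symmetrize (decode (encode (adj (str F)))))
  iso = ≗⇒↪ λ i j → trans (cong₂ (λ a b → not (does (i ≟ j)) ∧ a ∧ b) (decode-encode _ i j) (decode-encode _ j i))
                          (symmetrize-adj (str F) i j)

graphsUpTo : ℕ → List Graph
graphsUpTo N = List.concat (List.applyUpTo graphsOfSize (suc N))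

graphsUpTo-complete : ∀ {N} F → size F ≤ N → Any (F ≅_) (graphsUpTo N)
graphsUpTo-complete F size≤N = Any.concat⁺ (Any.applyUpTo⁺ graphsOfSize (graphsOfSize-complete F) (s≤s size≤N))

locallyDetermined⇒hasFiniteForbidden : ∀ {N 𝒢} → LocallyDetermined N 𝒢 → HasFiniteForbidden 𝒢
locallyDetermined⇒hasFiniteForbidden {N} {𝒢} local = graphsUpTo N , λ F F-forbidden →
  graphsUpTo-complete F (size≤N F F-forbidden)
  where
  size≤N : ∀ F → Forbidden 𝒢 F → size F ≤ N
  size≤N F (F∉ , smaller∈) with size F ≤? N
  ... | yes size≤N = size≤N
  ... | no  size≰N = ⊥-elim (local F F∉ λ (W , ∣W∣≤N , W∉) →
                       W∉ (smaller∈ (F [ W ]) ([]↪ F W) (≤-<-trans ∣W∣≤N (≰⇒> size≰N))))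

-- Counting added edges

added : ∀ {n} → SimpleAdj n → SimpleAdj n → Fin n → Fin n → Bool
added A B i j = adj B i j ∧ not (adj A i j)

addedAbove : ∀ {n} → SimpleAdj n → SimpleAdj n → Fin n → Fin n → Bool
addedAbove A B i j = (toℕ i <ᵇ toℕ j) ∧ added A B i j

edgeDiff-∑ : ∀ {n} (A B : SimpleAdj n) → edgeDiff A B ≡ ∑[ i < n ] ∑[ j < n ] 𝟙 (addedAbove A B i j)
edgeDiff-∑ {n} A B = trans (sum-map-allFin n _) (sum-cong-≗ λ i → sum-map-allFin n (𝟙 ∘ addedAbove A B i))

edgeDiff-cong : ∀ {n} (A B A′ B′ : SimpleAdj n) → (∀ i j → added A B i j ≡ added A′ B′ i j) →
                edgeDiff A B ≡ edgeDiff A′ B′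
edgeDiff-cong A B A′ B′ eq = begin
  edgeDiff A B                                     ≡⟨ edgeDiff-∑ A B ⟩
  ∑[ i < _ ] ∑[ j < _ ] 𝟙 (addedAbove A B i j)     ≡⟨ sum-cong-≗ (λ i → sum-cong-≗ λ j →
                                                        cong (λ b → 𝟙 ((toℕ i <ᵇ toℕ j) ∧ b)) (eq i j)) ⟩
  ∑[ i < _ ] ∑[ j < _ ] 𝟙 (addedAbove A′ B′ i j)   ≡⟨ edgeDiff-∑ A′ B′ ⟨
  edgeDiff A′ B′                                   ∎
  where open ≡-Reasoning

edgeDiff-self : ∀ {n} (A : SimpleAdj n) → edgeDiff A A ≡ 0
edgeDiff-self A = trans (edgeDiff-∑ A A) (∑-zero λ i → ∑-zero λ j →
  cong 𝟙 (trans (cong ((toℕ i <ᵇ toℕ j) ∧_) (∧-inverseʳ (adj A i j))) (∧-zeroʳ _)))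

𝟙-added-trans : ∀ {a b c} → (a ≡ true → b ≡ true) → (b ≡ true → c ≡ true) →
                𝟙 (c ∧ not a) ≡ 𝟙 (b ∧ not a) + 𝟙 (c ∧ not b)
𝟙-added-trans {true}  {true}  {true}  _   _   = refl
𝟙-added-trans {true}  {true}  {false} _   b⇒c with () ← b⇒c refl
𝟙-added-trans {true}  {false}         a⇒b _   with () ← a⇒b refl
𝟙-added-trans {false} {true}  {true}  _   _   = refl
𝟙-added-trans {false} {true}  {false} _   b⇒c with () ← b⇒c refl
𝟙-added-trans {false} {false}         _   _   = refl

edgeDiff-trans : ∀ {n} {A B C : SimpleAdj n} → A ⊆E B → B ⊆E C →
                 edgeDiff A C ≡ edgeDiff A B + edgeDiff B C
edgeDiff-trans {n} {A} {B} {C} A⊆B B⊆C = begin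
  edgeDiff A C                                                   ≡⟨ edgeDiff-∑ A C ⟩
  ∑[ i < n ] ∑[ j < n ] count A C i j                            ≡⟨ sum-cong-≗ (λ i → sum-cong-≗ (split i)) ⟩
  ∑[ i < n ] ∑[ j < n ] (count A B i j + count B C i j)          ≡⟨ sum-cong-≗ (λ i → ∑-distrib-+ (count A B i) (count B C i)) ⟩
  ∑[ i < n ] (sum (count A B i) + sum (count B C i))             ≡⟨ ∑-distrib-+ (sum ∘ count A B) (sum ∘ count B C) ⟩
  ∑[ i < n ] sum (count A B i) + ∑[ i < n ] sum (count B C i)    ≡⟨ cong₂ _+_ (edgeDiff-∑ A B) (edgeDiff-∑ B C) ⟨
  edgeDiff A B + edgeDiff B C                                    ∎
  where
  open ≡-Reasoning
  count : SimpleAdj n → SimpleAdj n → Fin n → Fin n → ℕ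
  count X Y i j = 𝟙 (addedAbove X Y i j)
  split : ∀ i j → count A C i j ≡ count A B i j + count B C i j
  split i j with toℕ i <ᵇ toℕ j
  ... | true  = 𝟙-added-trans (A⊆B i j) (B⊆C i j)
  ... | false = refl

<ᵇ-true : ∀ {m n} → m < n → (m <ᵇ n) ≡ true
<ᵇ-true = Equivalence.to T-≡ ∘ <⇒<ᵇ

<ᵇ-false : ∀ {m n} → ¬ m < n → (m <ᵇ n) ≡ false
<ᵇ-false {m} {n} m≮n = ¬-not (m≮n ∘ <ᵇ⇒< m n ∘ Equivalence.from T-≡)

𝟙-split : ∀ {n} (y : Fin n → Fin n → Bool) → (∀ i j → y i j ≡ y j i) → (∀ i → y i i ≡ false) →
          ∀ i j → 𝟙 (y i j) ≡ 𝟙 ((toℕ i <ᵇ toℕ j) ∧ y i j) + 𝟙 ((toℕ j <ᵇ toℕ i) ∧ y j i)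
𝟙-split y y-sym y-irr i j with <-cmp (toℕ i) (toℕ j)
... | tri< i<j _ j≮i rewrite <ᵇ-true i<j | <ᵇ-false j≮i = sym (+-identityʳ _)
... | tri> i≮j _ j<i rewrite <ᵇ-false i≮j | <ᵇ-true j<i = cong 𝟙 (y-sym i j)
... | tri≈ _ i≡j _ with refl ← Fin.toℕ-injective i≡j rewrite y-irr i | ∧-zeroʳ (toℕ i <ᵇ toℕ i) = refl

-- edgeDiff counts pairs i < j, an order that embeddings need not preserve; ordered
-- pairs avoid the order at the price of counting every pair twice.
orderedEdgeDiff : ∀ {n} → SimpleAdj n → SimpleAdj n → ℕ
orderedEdgeDiff {n} A B = ∑[ i < n ] ∑[ j < n ] 𝟙 (added A B i j)

orderedEdgeDiff≡2*edgeDiff : ∀ {n} (A B : SimpleAdj n) → orderedEdgeDiff A B ≡ 2 * edgeDiff A B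
orderedEdgeDiff≡2*edgeDiff {n} A B = begin
  ∑[ i < n ] ∑[ j < n ] 𝟙 (added A B i j)          ≡⟨ sum-cong-≗ (λ i → sum-cong-≗ (𝟙-split _ added-sym added-irr i)) ⟩
  ∑[ i < n ] ∑[ j < n ] (above i j + above j i)     ≡⟨ sum-cong-≗ (λ i → ∑-distrib-+ (above i) (λ j → above j i)) ⟩
  ∑[ i < n ] (sum (above i) + ∑[ j < n ] above j i) ≡⟨ ∑-distrib-+ (sum ∘ above) (λ i → ∑[ j < n ] above j i) ⟩
  E + ∑[ i < n ] ∑[ j < n ] above j i               ≡⟨ cong (E +_) (∑-comm (λ i j → above j i)) ⟩
  E + E                                             ≡⟨ cong (E +_) (+-identityʳ E) ⟨
  2 * E                                             ≡⟨ cong (2 *_) (edgeDiff-∑ A B) ⟨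
  2 * edgeDiff A B                                  ∎
  where
  open ≡-Reasoning
  above : Fin n → Fin n → ℕ
  above i j = 𝟙 (addedAbove A B i j)
  E : ℕ
  E = ∑[ i < n ] ∑[ j < n ] above i j
  added-sym : ∀ i j → added A B i j ≡ added A B j i
  added-sym i j = cong₂ (λ b a → b ∧ not a) (adj-sym B i j) (adj-sym A i j)
  added-irr : ∀ i → added A B i i ≡ false
  added-irr i = cong (_∧ not (adj A i i)) (adj-irr B i)

edgeDiff-restrict : ∀ {m n} {e : Fin m → Fin n} → Injective _≡_ _≡_ e → (A B : SimpleAdj n) →
                    edgeDiff (restrict A e) (restrict B e) ≤ edgeDiff A B
edgeDiff-restrict {e = e} inj A B = *-cancelˡ-≤ 2 (begin
  2 * edgeDiff (restrict A e) (restrict B e)       ≡⟨ orderedEdgeDiff≡2*edgeDiff (restrict A e) (restrict B e) ⟨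
  orderedEdgeDiff (restrict A e) (restrict B e)    ≤⟨ ∑-mono-≤ (λ i → ∑-injective-≤ inj (𝟙 ∘ added A B (e i))) ⟩
  ∑[ i < _ ] ∑[ j < _ ] 𝟙 (added A B (e i) j)      ≤⟨ ∑-injective-≤ inj (λ i → ∑[ j < _ ] 𝟙 (added A B i j)) ⟩
  orderedEdgeDiff A B                              ≡⟨ orderedEdgeDiff≡2*edgeDiff A B ⟩
  2 * edgeDiff A B                                 ∎)
  where open ≤-Reasoning

-- Adding edges

edge : ∀ {n} (u v : Fin n) → u ≢ v → SimpleAdj n
edge u v u≢v = record
  { adj = λ i j → does (i ≟ u) ∧ does (j ≟ v) ∨ does (i ≟ v) ∧ does (j ≟ u)
  ; sym = λ i j → trans (∨-comm (does (i ≟ u) ∧ does (j ≟ v)) _)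
                         (cong₂ _∨_ (∧-comm (does (i ≟ v)) _) (∧-comm (does (i ≟ u)) _))
  ; irr = irr
  }
  where
  irr : ∀ i → does (i ≟ u) ∧ does (i ≟ v) ∨ does (i ≟ v) ∧ does (i ≟ u) ≡ false
  irr i with i ≟ u | i ≟ v
  ... | yes refl | yes refl = contradiction refl u≢v
  ... | yes _    | no _     = refl
  ... | no _     | yes _    = refl
  ... | no _     | no _     = refl

edge-adj : ∀ {n} {u v : Fin n} {u≢v : u ≢ v} (A : SimpleAdj n) {i j} →
           adj (edge u v u≢v) i j ≡ true → adj A i j ≡ adj A u v
edge-adj {u = u} {v} A {i} {j} eij with i ≟ u | j ≟ v | i ≟ v | j ≟ u
... | yes refl | yes refl | _        | _        = refl
... | _        | _        | yes refl | yes refl = adj-sym A v u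
... | yes _    | no _     | yes _    | no _     with () ← eij
... | yes _    | no _     | no _     | _        with () ← eij
... | no _     | _        | yes _    | no _     with () ← eij
... | no _     | _        | no _     | _        with () ← eij

∑-δ : ∀ {n} (v : Fin n) → ∑[ i < n ] 𝟙 (does (i ≟ v)) ≡ 1
∑-δ v = trans (∑-pointMass v λ i i≢v → cong 𝟙 (dec-false (i ≟ v) i≢v)) (cong 𝟙 (dec-true (v ≟ v) refl))

edge-degree : ∀ {n} {u v : Fin n} (u≢v : u ≢ v) i →
              ∑[ j < n ] 𝟙 (adj (edge u v u≢v) i j) ≡ 𝟙 (does (i ≟ u)) + 𝟙 (does (i ≟ v))
edge-degree {n} {u} {v} u≢v i with i ≟ u | i ≟ v
... | yes refl | yes refl = contradiction refl u≢v
... | yes refl | no _     = trans (sum-cong-≗ λ j → cong 𝟙 (∨-identityʳ (does (j ≟ v)))) (∑-δ v)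
... | no _     | yes refl = ∑-δ u
... | no _     | no _     = ∑-zero {n} λ _ → refl

∑∑-edge : ∀ {n} {u v : Fin n} (u≢v : u ≢ v) →
          ∑[ i < n ] ∑[ j < n ] 𝟙 (adj (edge u v u≢v) i j) ≡ 2
∑∑-edge {n} {u} {v} u≢v = begin
  ∑[ i < _ ] ∑[ j < _ ] 𝟙 (adj (edge u v u≢v) i j)          ≡⟨ sum-cong-≗ (edge-degree u≢v) ⟩
  ∑[ i < _ ] (𝟙 (does (i ≟ u)) + 𝟙 (does (i ≟ v)))           ≡⟨ ∑-distrib-+ (δ u) (δ v) ⟩
  ∑[ i < _ ] 𝟙 (does (i ≟ u)) + ∑[ i < _ ] 𝟙 (does (i ≟ v))  ≡⟨ cong₂ _+_ (∑-δ u) (∑-δ v) ⟩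
  2                                                         ∎
  where
  open ≡-Reasoning
  δ : Fin n → Fin n → ℕ
  δ w i = 𝟙 (does (i ≟ w))

infixr 30 _∪ᴬ_
_∪ᴬ_ : ∀ {n} → SimpleAdj n → SimpleAdj n → SimpleAdj n
A ∪ᴬ B = record
  { adj = λ i j → adj A i j ∨ adj B i j
  ; sym = λ i j → cong₂ _∨_ (adj-sym A i j) (adj-sym B i j)
  ; irr = λ i → cong₂ _∨_ (adj-irr A i) (adj-irr B i)
  }

A⊆EA∪B : ∀ {n} (A B : SimpleAdj n) → A ⊆E A ∪ᴬ B
A⊆EA∪B A B i j Aij rewrite Aij = refl

∪ᴬ-least : ∀ {n} {A B C : SimpleAdj n} → A ⊆E C → B ⊆E C → A ∪ᴬ B ⊆E C
∪ᴬ-least {A = A} A⊆C B⊆C i j eij with adj A i j in Aij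
... | true  = A⊆C i j Aij
... | false = B⊆C i j eij

∪ᴬ-edge-⊆E : ∀ {n} (A B : SimpleAdj n) {u v} (u≢v : u ≢ v) → A ⊆E B → adj B u v ≡ true →
             A ∪ᴬ edge u v u≢v ⊆E B
∪ᴬ-edge-⊆E A B u≢v A⊆B Buv =
  ∪ᴬ-least {A = A} {edge _ _ u≢v} {B} A⊆B λ i j eij → trans (edge-adj {u≢v = u≢v} B eij) Buv

edgeDiff-∪ᴬ-edge : ∀ {n} (A : SimpleAdj n) {u v} (u≢v : u ≢ v) → adj A u v ≡ false →
                   edgeDiff A (A ∪ᴬ edge u v u≢v) ≡ 1
edgeDiff-∪ᴬ-edge {n} A {u} {v} u≢v Auv = *-cancelˡ-≡ _ 1 2 (begin
  2 * edgeDiff A (A ∪ᴬ E)                          ≡⟨ orderedEdgeDiff≡2*edgeDiff A (A ∪ᴬ E) ⟨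
  orderedEdgeDiff A (A ∪ᴬ E)                       ≡⟨ sum-cong-≗ (λ i → sum-cong-≗ λ j → cong 𝟙 (new-is-edge i j)) ⟩
  ∑[ i < n ] ∑[ j < n ] 𝟙 (adj E i j)              ≡⟨ ∑∑-edge u≢v ⟩
  2                                                ∎)
  where
  open ≡-Reasoning
  E : SimpleAdj n
  E = edge u v u≢v
  new-is-edge : ∀ i j → added A (A ∪ᴬ E) i j ≡ adj E i j
  new-is-edge i j with adj A i j in Aij | adj E i j in Eij
  ... | false | e     = ∧-identityʳ e
  ... | true  | false = refl
  ... | true  | true  = contradiction (trans (sym Aij) (trans (edge-adj {u≢v = u≢v} A Eij) Auv)) λ ()

override : ∀ {m} → SimpleAdj m → Maybe (Fin m) → Maybe (Fin m) → Bool → Bool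
override B (just k) (just l) _ = adj B k l
override B (just _) nothing  a = a
override B nothing  _        a = a

override-sym : ∀ {m} (B : SimpleAdj m) x y a → override B x y a ≡ override B y x a
override-sym B (just k) (just l) a = adj-sym B k l
override-sym B (just _) nothing  a = refl
override-sym B nothing  (just _) a = refl
override-sym B nothing  nothing  a = refl

override-irr : ∀ {m} (B : SimpleAdj m) x → override B x x false ≡ false
override-irr B (just k) = adj-irr B k
override-irr B nothing  = refl

override-nothingʳ : ∀ {m} (B : SimpleAdj m) x a → override B x nothing a ≡ a
override-nothingʳ B (just _) a = refl
override-nothingʳ B nothing  a = refl

extend : ∀ {n} (A : SimpleAdj n) (W : Subset n) → SimpleAdj ∣ W ∣ → SimpleAdj n
extend A W B = record
  { adj = λ i j → override B (position W i) (position W j) (adj A i j)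
  ; sym = λ i j → trans (cong (override B (position W i) (position W j)) (adj-sym A i j))
                        (override-sym B (position W i) (position W j) (adj A j i))
  ; irr = λ i → trans (cong (override B (position W i) (position W i)) (adj-irr A i))
                      (override-irr B (position W i))
  }

extend-enum : ∀ {n} (A : SimpleAdj n) W B k l → adj (extend A W B) (enum W k) (enum W l) ≡ adj B k l
extend-enum A W B k l rewrite position-enum W k | position-enum W l = refl

extend-outside : ∀ {n} (A : SimpleAdj n) W B {i j} → i ∉ W ⊎ j ∉ W → adj (extend A W B) i j ≡ adj A i j
extend-outside A W B (inj₁ i∉W) rewrite position-∉ i∉W = refl
extend-outside A W B {i} (inj₂ j∉W) rewrite position-∉ j∉W = override-nothingʳ B (position W i) _

⊆E-extend : ∀ {n} (A : SimpleAdj n) W B → restrict A (enum W) ⊆E B → A ⊆E extend A W B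
⊆E-extend A W B A[W]⊆B i j Aij with position W i in posᵢ | position W j in posⱼ
... | just k  | just l  = A[W]⊆B k l (trans (cong₂ (adj A) (position-just W i posᵢ) (position-just W j posⱼ)) Aij)
... | just _  | nothing = Aij
... | nothing | _       = Aij

edgeDiff-extend : ∀ {n} (A : SimpleAdj n) W B → edgeDiff A (extend A W B) ≡ edgeDiff (restrict A (enum W)) B
edgeDiff-extend {n} A W B = *-cancelˡ-≡ _ _ 2 (begin
  2 * edgeDiff A A′                                           ≡⟨ orderedEdgeDiff≡2*edgeDiff A A′ ⟨
  ∑[ i < n ] ∑[ j < n ] 𝟙 (added A A′ i j)                    ≡⟨ ∑-support W (λ i i∉W → ∑-zero λ j →
                                                                   new-inside {i} {j} (inj₁ i∉W)) ⟩
  ∑[ k < ∣ W ∣ ] ∑[ j < n ] 𝟙 (added A A′ (enum W k) j)       ≡⟨ sum-cong-≗ (λ k → ∑-support W λ j j∉W →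
                                                                   new-inside {enum W k} {j} (inj₂ j∉W)) ⟩
  ∑[ k < ∣ W ∣ ] ∑[ l < ∣ W ∣ ] 𝟙 (added A A′ (enum W k) (enum W l))
                                                              ≡⟨ sum-cong-≗ (λ k → sum-cong-≗ λ l →
                                                                   cong (λ b → 𝟙 (b ∧ _)) (extend-enum A W B k l)) ⟩
  orderedEdgeDiff (restrict A (enum W)) B                     ≡⟨ orderedEdgeDiff≡2*edgeDiff (restrict A (enum W)) B ⟩
  2 * edgeDiff (restrict A (enum W)) B                        ∎)
  where
  open ≡-Reasoning
  A′ : SimpleAdj n
  A′ = extend A W B
  new-inside : ∀ {i j} → i ∉ W ⊎ j ∉ W → 𝟙 (added A A′ i j) ≡ 0
  new-inside {i} {j} i∉W⊎j∉W = cong 𝟙 (trans (cong (_∧ not (adj A i j)) (extend-outside A W B i∉W⊎j∉W))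
                                              (∧-inverseʳ (adj A i j)))

adj⇒≢ : ∀ {n} (B : SimpleAdj n) {u v} → adj B u v ≡ true → u ≢ v
adj⇒≢ B {u} Buv refl = contradiction (trans (sym Buv) (adj-irr B u)) λ ()

edgeDiff-through-edge : ∀ {n} (A B : SimpleAdj n) {u v} (u≢v : u ≢ v) → adj A u v ≡ false →
                        A ∪ᴬ edge u v u≢v ⊆E B → edgeDiff A B ≡ suc (edgeDiff (A ∪ᴬ edge u v u≢v) B)
edgeDiff-through-edge {n} A B {u} {v} u≢v Auv A∪E⊆B =
  trans (edgeDiff-trans {A = A} {A ∪ᴬ E} {B} (A⊆EA∪B A E) A∪E⊆B)
        (cong (_+ edgeDiff (A ∪ᴬ E) B) (edgeDiff-∪ᴬ-edge A u≢v Auv))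
  where
  E : SimpleAdj n
  E = edge u v u≢v

edgeAdd-hereditary : ∀ {𝒢} → Hereditary 𝒢 → ∀ p → Hereditary (EdgeAdd p 𝒢)
edgeAdd-hereditary her p G H e (B , A⊆B , diff≤p , B∈) =
    B′
  , (λ i j Hij → A⊆B _ _ (trans (preserves e i j) Hij))
  , ≤-trans (≤-reflexive (edgeDiff-cong (str H) B′ (restrict (str G) (emb e)) B′ λ i j →
                              cong (λ a → adj B (emb e i) (emb e j) ∧ not a) (sym (preserves e i j))))
            (≤-trans (edgeDiff-restrict (injective e) (str G) B) diff≤p)
  , her _ _ (restrict-↪ B (injective e)) B∈
  where
  B′ : SimpleAdj (size H)
  B′ = restrict B (emb e)

≢-under-⇒ : ∀ {a b} → (a ≡ true → b ≡ true) → b ≢ a → b ≡ true × a ≡ false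
≢-under-⇒ {false} {true}  _   _   = refl , refl
≢-under-⇒ {false} {false} _   b≢a = contradiction refl b≢a
≢-under-⇒ {true}          a⇒b b≢a = contradiction (a⇒b refl) b≢a

member⇒edgeAdd : ∀ {𝒢 n p} (A : SimpleAdj n) → 𝒢 (mkGraph n A) → EdgeAdd p 𝒢 (mkGraph n A)
member⇒edgeAdd {p = p} A A∈ = A , (λ _ _ → id) , subst (_≤ p) (sym (edgeDiff-self A)) z≤n , A∈

edgeAddBound : ℕ → ℕ → ℕ
edgeAddBound N zero    = N
edgeAddBound N (suc p) = N + N * (N * edgeAddBound N p)

module _ {𝒢 : Class} (her : Hereditary 𝒢) where

  differing-pair : ∀ {n} {A B : SimpleAdj n} (W : Subset n) → A ⊆E B →
                   ¬ 𝒢 (mkGraph n A [ W ]) → 𝒢 (mkGraph n B [ W ]) →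
                   ∃ λ k → ∃ λ l → adj B (enum W k) (enum W l) ≡ true × adj A (enum W k) (enum W l) ≡ false
  differing-pair {n} {A} {B} W A⊆B A∉ B∈ = decide (Fin.all? λ k → Fin.all? (agree? k))
    where
    agree? : ∀ k l → Dec (adj B (enum W k) (enum W l) ≡ adj A (enum W k) (enum W l))
    agree? k l = adj B (enum W k) (enum W l) Bool.≟ adj A (enum W k) (enum W l)
    decide : Dec (∀ k l → adj B (enum W k) (enum W l) ≡ adj A (enum W k) (enum W l)) →
             ∃ λ k → ∃ λ l → adj B (enum W k) (enum W l) ≡ true × adj A (enum W k) (enum W l) ≡ false
    decide (yes agree) = contradiction (her _ _ (≗⇒↪ agree) B∈) A∉
    decide (no ¬agree) =
      let (k , ¬row) = Fin.¬∀⟶∃¬ _ _ (λ k → Fin.all? (agree? k)) ¬agree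
          (l , ≢)    = Fin.¬∀⟶∃¬ _ _ (agree? k) ¬row
      in k , l , ≢-under-⇒ (A⊆B _ _) ≢

  module _ {N} (local : LocallyDetermined N 𝒢) {n : ℕ} where

    Obstruction : ℕ → SimpleAdj n → Subset n → Set
    Obstruction p A W = ∀ B → A ⊆E B → edgeDiff A B ≤ p → ¬ 𝒢 (mkGraph n B [ W ])

    ThroughEdge : ℕ → SimpleAdj n → Fin n → Fin n → Subset n → Set
    ThroughEdge p A u v W = ∀ B → A ⊆E B → adj B u v ≡ true → adj A u v ≡ false →
                            edgeDiff A B ≤ suc p → ¬ 𝒢 (mkGraph n B [ W ])

    obstruction-∪ : ∀ {p A W₀} → ¬ 𝒢 (mkGraph n A [ W₀ ]) → (W : Fin ∣ W₀ ∣ → Fin ∣ W₀ ∣ → Subset n) →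
                    (∀ k l → ThroughEdge p A (enum W₀ k) (enum W₀ l) (W k l)) →
                    Obstruction (suc p) A (W₀ ∪ ⋃ᶠ (λ k → ⋃ᶠ (W k)))
    obstruction-∪ {A = A} {W₀} W₀∉ W through B A⊆B diff≤ B∈ =
      let W₀∈ : 𝒢 (mkGraph n B [ W₀ ])
          W₀∈ = her _ _ (⊆⇒[]↪[] (mkGraph n B) (p⊆p∪q _)) B∈
          (k , l , Buv , Auv) = differing-pair {A = A} {B} W₀ A⊆B W₀∉ W₀∈
          Wₖₗ⊆W : W k l ⊆ W₀ ∪ ⋃ᶠ (λ k → ⋃ᶠ (W k))
          Wₖₗ⊆W = q⊆p∪q W₀ _ ∘ fk⊆⋃ᶠf (λ k → ⋃ᶠ (W k)) k ∘ fk⊆⋃ᶠf (W k) l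
      in ∉-mono her (mkGraph n B) Wₖₗ⊆W (through k l B A⊆B Buv Auv diff≤) B∈

    obstruction : ∀ p A → ¬ EdgeAdd p 𝒢 (mkGraph n A) →
                  ¬ ¬ ∃ λ W → ∣ W ∣ ≤ edgeAddBound N p × Obstruction p A W
    through-edge : ∀ p A → ¬ EdgeAdd (suc p) 𝒢 (mkGraph n A) → ∀ u v →
                   ¬ ¬ ∃ λ W → ∣ W ∣ ≤ edgeAddBound N p × ThroughEdge p A u v W

    obstruction zero A A∉ = do
      (W₀ , ∣W₀∣≤N , W₀∉) ← local (mkGraph n A) (A∉ ∘ member⇒edgeAdd {𝒢} A)
      pure (W₀ , ∣W₀∣≤N , λ B A⊆B diff≤0 B∈ →
        let (k , l , Buv , Auv) = differing-pair {A = A} {B} W₀ A⊆B W₀∉ B∈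
            u≢v = adj⇒≢ B Buv
            diff≡suc = edgeDiff-through-edge A B u≢v Auv (∪ᴬ-edge-⊆E A B u≢v A⊆B Buv)
        in contradiction (subst (_≤ 0) diff≡suc diff≤0) λ ())
    obstruction (suc p) A A∉ = do
      (W₀ , ∣W₀∣≤N , W₀∉) ← local (mkGraph n A) (A∉ ∘ member⇒edgeAdd {𝒢} A)
      Ws ← ∀¬¬⇒¬¬∀ λ k → ∀¬¬⇒¬¬∀ λ l → through-edge p A A∉ (enum W₀ k) (enum W₀ l)
      let W : Fin ∣ W₀ ∣ → Fin ∣ W₀ ∣ → Subset n
          W k l = proj₁ (Ws k l)
      pure ( W₀ ∪ ⋃ᶠ (λ k → ⋃ᶠ (W k))
           , ≤-trans (∣p∪q∣≤∣p∣+∣q∣ W₀ _) (+-mono-≤ ∣W₀∣≤N (≤-trans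
               (∣⋃ᶠf∣≤m*N _ λ k → ∣⋃ᶠf∣≤m*N (W k) λ l → proj₁ (proj₂ (Ws k l)))
               (*-mono-≤ ∣W₀∣≤N (*-monoˡ-≤ (edgeAddBound N p) ∣W₀∣≤N))))
           , obstruction-∪ {A = A} W₀∉ W (λ k l → proj₂ (proj₂ (Ws k l))) )

    through-edge p A A∉ u v with adj A u v in Auv | u ≟ v
    ... | true  | _        = pure (⊥ , ∣⊥∣≤m {n} , λ _ _ _ ())
    ... | false | yes refl = pure (⊥ , ∣⊥∣≤m {n} , λ B _ Buu → contradiction (trans (sym Buu) (adj-irr B u)) λ ())
    ... | false | no u≢v   = do
      (W , ∣W∣≤ , obs) ← obstruction p (A ∪ᴬ E) A∪E∉
      pure (W , ∣W∣≤ , λ B A⊆B Buv _ diff≤ →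
        let A∪E⊆B = ∪ᴬ-edge-⊆E A B u≢v A⊆B Buv
        in obs B A∪E⊆B (≤-pred (subst (_≤ suc p) (edgeDiff-through-edge A B u≢v Auv A∪E⊆B) diff≤)))
      where
      E : SimpleAdj n
      E = edge u v u≢v
      A∪E∉ : ¬ EdgeAdd p 𝒢 (mkGraph n (A ∪ᴬ E))
      A∪E∉ (B , A∪E⊆B , diff≤p , B∈) =
        A∉ ( B , (λ i j → A∪E⊆B i j ∘ A⊆EA∪B A E i j)
           , subst (_≤ suc p) (sym (edgeDiff-through-edge A B u≢v Auv A∪E⊆B)) (s≤s diff≤p) , B∈ )

  edgeAdd-locallyDetermined : ∀ {N} → LocallyDetermined N 𝒢 → ∀ p → LocallyDetermined (edgeAddBound N p) (EdgeAdd p 𝒢)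
  edgeAdd-locallyDetermined local p G G∉ = do
    (W , ∣W∣≤ , obs) ← obstruction local p (str G) G∉
    pure (W , ∣W∣≤ , λ (B , A[W]⊆B , diff≤p , B∈) →
      obs (extend (str G) W B) (⊆E-extend (str G) W B A[W]⊆B)
          (subst (_≤ p) (sym (edgeDiff-extend (str G) W B)) diff≤p)
          (her _ _ (≗⇒↪ λ k l → sym (extend-enum (str G) W B k l)) B∈))

-- Complements and deleting edges

≟-injective : ∀ {m n} {e : Fin m → Fin n} → Injective _≡_ _≡_ e → ∀ i j → does (e i ≟ e j) ≡ does (i ≟ j)
≟-injective {e = e} inj i j = does-⇔ (mk⇔ inj (cong e)) (e i ≟ e j) (i ≟ j)

complement : ∀ {n} → SimpleAdj n → SimpleAdj n
complement A = record
  { adj = λ i j → not (does (i ≟ j)) ∧ not (adj A i j)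
  ; sym = λ i j → cong₂ (λ d a → not d ∧ not a) (≟-sym i j) (adj-sym A i j)
  ; irr = λ i → cong (λ d → not d ∧ not (adj A i i)) (dec-true (i ≟ i) refl)
  }

co : Graph → Graph
co G = mkGraph (size G) (complement (str G))

complement-involutive : ∀ {n} (A : SimpleAdj n) i j → adj (complement (complement A)) i j ≡ adj A i j
complement-involutive A i j with i ≟ j
... | yes refl = sym (adj-irr A i)
... | no  _    = not-involutive (adj A i j)

∧-not-antitone : ∀ {a b d} → (a ≡ true → b ≡ true) → d ∧ not b ≡ true → d ∧ not a ≡ true
∧-not-antitone {d = false}                 _   ()
∧-not-antitone {false}         {d = true}  _   _  = refl
∧-not-antitone {true}  {true}  {true}      _   ()
∧-not-antitone {true}  {false} {true}      a⇒b _  with () ← a⇒b refl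

complement-⊆E : ∀ {n} (A B : SimpleAdj n) → A ⊆E B → complement B ⊆E complement A
complement-⊆E A B A⊆B i j = ∧-not-antitone {d = not (does (i ≟ j))} (A⊆B i j)

added-complement : ∀ {n} (A B : SimpleAdj n) i j → added (complement A) (complement B) i j ≡ added B A i j
added-complement A B i j with i ≟ j
... | yes refl rewrite adj-irr A i = refl
... | no  _    = trans (cong (not (adj B i j) ∧_) (not-involutive (adj A i j))) (∧-comm _ (adj A i j))

co-↪ : ∀ {H G} → H ↪ G → co H ↪ co G
co-↪ e = record
  { emb       = emb e
  ; injective = injective e
  ; preserves = λ i j → cong₂ (λ d a → not d ∧ not a) (≟-injective (injective e) i j) (preserves e i j)
  }

co[]↪co : ∀ G (W : Subset (size G)) → co G [ W ] ↪ co (G [ W ])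
co[]↪co G W = factor (co-↪ ([]↪ G W)) ([]↪ (co G) W) λ k → k , refl

Complement : Class → Class
Complement 𝒢 G = 𝒢 (co G)

module _ {𝒢 : Class} (her : Hereditary 𝒢) where

  complement-hereditary : Hereditary (Complement 𝒢)
  complement-hereditary G H e = her (co G) (co H) (co-↪ e)

  complement-locallyDetermined : ∀ {N} → LocallyDetermined N 𝒢 → LocallyDetermined N (Complement 𝒢)
  complement-locallyDetermined local G G∉ = do
    (W , ∣W∣≤N , W∉) ← local (co G) G∉
    pure (W , ∣W∣≤N , W∉ ∘ her _ _ (co[]↪co G W))

  edgeApex⇒edgeAdd : ∀ {q} G → EdgeApex q 𝒢 G → EdgeAdd q (Complement 𝒢) (co G)
  edgeApex⇒edgeAdd G (B , B⊆A , diff≤q , B∈) =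
      complement B
    , complement-⊆E B (str G) B⊆A
    , subst (_≤ _) (sym (edgeDiff-cong (complement (str G)) (complement B) B (str G)
                                       (added-complement (str G) B))) diff≤q
    , her _ _ (≗⇒↪ λ i j → sym (complement-involutive B i j)) B∈

  edgeAdd⇒edgeApex : ∀ {q} G → EdgeAdd q (Complement 𝒢) (co G) → EdgeApex q 𝒢 G
  edgeAdd⇒edgeApex G (B , coA⊆B , diff≤q , B∈) =
      complement B
    , (λ i j coBij → trans (sym (complement-involutive A i j)) (complement-⊆E (complement A) B coA⊆B i j coBij))
    , subst (_≤ _) (edgeDiff-cong (complement A) B (complement B) A λ i j →
        trans (cong (_∧ not (adj (complement A) i j)) (sym (complement-involutive B i j)))
              (added-complement A (complement B) i j)) diff≤q
    , B∈
    where
    A : SimpleAdj (size G)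
    A = str G

  edgeApex-hereditary : ∀ q → Hereditary (EdgeApex q 𝒢)
  edgeApex-hereditary q G H e G∈ =
    edgeAdd⇒edgeApex H (edgeAdd-hereditary complement-hereditary q (co G) (co H) (co-↪ e) (edgeApex⇒edgeAdd G G∈))

  edgeApex-locallyDetermined : ∀ {N} → LocallyDetermined N 𝒢 → ∀ q →
                               LocallyDetermined (edgeAddBound N q) (EdgeApex q 𝒢)
  edgeApex-locallyDetermined local q G G∉ = do
    (W , ∣W∣≤ , W∉) ← edgeAdd-locallyDetermined complement-hereditary (complement-locallyDetermined local) q
                        (co G) (G∉ ∘ edgeAdd⇒edgeApex G)
    pure (W , ∣W∣≤ , λ W∈ → W∉ (edgeAdd-hereditary complement-hereditary q _ _ (co[]↪co G W)
                                  (edgeApex⇒edgeAdd (G [ W ]) W∈)))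

-- Deleting vertices

vertexApex-hereditary : ∀ {𝒢} → Hereditary 𝒢 → ∀ r → Hereditary (VertexApex r 𝒢)
vertexApex-hereditary her r G H e (K , f , G≤K+r , K∈) = H [ T ] , []↪ H T , H≤T+r , her K (H [ T ]) T↪K K∈
  where
  I : Subset (size G)
  I = image (emb f)
  T : Subset (size H)
  T = select λ h → emb e h ∈? I
  T↪K : H [ T ] ↪ K
  T↪K = factor f (↪-trans ([]↪ H T) e) λ t → ∈-image (emb f) (∈-select⁻ (λ h → emb e h ∈? I) (enum-∈ T t))
  ∣∁T∣≤r : ∣ ∁ T ∣ ≤ r
  ∣∁T∣≤r = begin
    ∣ ∁ T ∣             ≤⟨ injective⇒∣p∣≤∣q∣ (injective e) (λ h∈∁T → x∉p⇒x∈∁p λ eh∈I →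
                             x∈∁p⇒x∉p h∈∁T (∈-select⁺ (λ h → emb e h ∈? I) eh∈I)) ⟩
    ∣ ∁ I ∣             ≡⟨ ∣∁p∣≡n∸∣p∣ I ⟩
    size G ∸ ∣ I ∣      ≤⟨ ∸-monoʳ-≤ (size G) (↪-size (↪[image] f)) ⟩
    size G ∸ size K     ≤⟨ m≤n+o⇒m∸n≤o (size G) (size K) G≤K+r ⟩
    r                   ∎
    where open ≤-Reasoning
  H≤T+r : size H ≤ ∣ T ∣ + r
  H≤T+r = begin
    size H                    ≡⟨ m+[n∸m]≡n (∣p∣≤n T) ⟨
    ∣ T ∣ + (size H ∸ ∣ T ∣)  ≡⟨ cong (∣ T ∣ +_) (∣∁p∣≡n∸∣p∣ T) ⟨
    ∣ T ∣ + ∣ ∁ T ∣           ≤⟨ +-monoʳ-≤ ∣ T ∣ ∣∁T∣≤r ⟩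
    ∣ T ∣ + r                 ∎
    where open ≤-Reasoning

p─[p─q]⊆q : ∀ {n} (p q : Subset n) → p ─ (p ─ q) ⊆ q
p─[p─q]⊆q p q {x} x∈ with x ∈? q
... | yes x∈q = x∈q
... | no  x∉q = contradiction (x∈p∧x∉q⇒x∈p─q (p─q⊆p p _ x∈) x∉q) (x∈p─q⇒x∉q x∈)

vertexApexBound : ℕ → ℕ → ℕ
vertexApexBound N zero    = N
vertexApexBound N (suc r) = N + N * vertexApexBound N r

module _ {𝒢 : Class} (her : Hereditary 𝒢) (G : Graph) where

  Far : ℕ → Subset (size G) → Set
  Far r U = ∀ X → ∣ X ∣ ≤ r → ¬ 𝒢 (G [ U ─ X ])

  far⇒∉ : ∀ {r U} → Far r U → ¬ 𝒢 (G [ U ])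
  far⇒∉ {U = U} far = subst (λ V → ¬ 𝒢 (G [ V ])) (p─⊥≡p U) (far ⊥ (∣⊥∣≤m {size G}))

  ¬vertexApex⇒far : ∀ {r} → ¬ VertexApex r 𝒢 G → Far r ⊤
  ¬vertexApex⇒far {r} G∉ X ∣X∣≤r ⊤─X∈ = G∉ (G [ ⊤ ─ X ] , []↪ G _ , G≤ , ⊤─X∈)
    where
    G≤ : size G ≤ ∣ ⊤ ─ X ∣ + r
    G≤ = begin
      size G              ≡⟨ ∣⊤∣≡n (size G) ⟨
      ∣ ⊤ {size G} ∣      ≤⟨ ∣p∣≤∣p─q∣+∣q∣ ⊤ X ⟩
      ∣ ⊤ ─ X ∣ + ∣ X ∣   ≤⟨ +-monoʳ-≤ ∣ ⊤ ─ X ∣ ∣X∣≤r ⟩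
      ∣ ⊤ ─ X ∣ + r       ∎
      where open ≤-Reasoning

  far⇒¬vertexApex : ∀ {r W} → Far r W → ¬ VertexApex r 𝒢 (G [ W ])
  far⇒¬vertexApex {r} {W} far (K , f , W≤K+r , K∈) =
    far (W ─ T) ∣W─T∣≤r (her _ _ (↪-trans (⊆⇒[]↪[] G (p─[p─q]⊆q W T)) ([image]↪ f′)) K∈)
    where
    f′ : K ↪ G
    f′ = ↪-trans f ([]↪ G W)
    T : Subset (size G)
    T = image (emb f′)
    T⊆W : T ⊆ W
    T⊆W x∈T = subst (_∈ W) (proj₂ (∈-image (emb f′) x∈T)) (enum-∈ W _)
    ∣W─T∣≤r : ∣ W ─ T ∣ ≤ r
    ∣W─T∣≤r = +-cancelʳ-≤ ∣ T ∣ ∣ W ─ T ∣ r (begin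
      ∣ W ─ T ∣ + ∣ T ∣   ≤⟨ q⊆p⇒∣p─q∣+∣q∣≤∣p∣ T⊆W ⟩
      ∣ W ∣               ≤⟨ W≤K+r ⟩
      size K + r          ≤⟨ +-monoˡ-≤ r (↪-size (↪[image] f′)) ⟩
      ∣ T ∣ + r           ≡⟨ +-comm ∣ T ∣ r ⟩
      r + ∣ T ∣           ∎)
      where open ≤-Reasoning

  far-remove : ∀ {r U} → Far (suc r) U → ∀ v → Far r (U - v)
  far-remove {r} {U} far v X ∣X∣≤r =
    subst (λ V → ¬ 𝒢 (G [ V ])) (sym (p─q─r≡p─q∪r U ⁅ v ⁆ X)) (far (⁅ v ⁆ ∪ X) ∣v∪X∣≤1+r)
    where
    ∣v∪X∣≤1+r : ∣ ⁅ v ⁆ ∪ X ∣ ≤ suc r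
    ∣v∪X∣≤1+r = ≤-trans (∣p∪q∣≤∣p∣+∣q∣ ⁅ v ⁆ X)
                        (subst (_≤ suc r) (sym (cong (_+ ∣ X ∣) (∣⁅x⁆∣≡1 v))) (s≤s ∣X∣≤r))

  avoiding-∉ : ∀ {W₀ W X} → W₀ ⊆ W → (∀ k → enum W₀ k ∉ X) → ¬ 𝒢 (G [ W₀ ]) → ¬ 𝒢 (G [ W ─ X ])
  avoiding-∉ {W₀} W₀⊆W avoids = ∉-mono her G λ x∈W₀ →
    let (k , enumₖ≡x) = ∈⇒enum x∈W₀
    in x∈p∧x∉q⇒x∈p─q (W₀⊆W x∈W₀) (subst (_∉ _) enumₖ≡x (avoids k))

  far-∪ : ∀ {r W₀} (W : Fin ∣ W₀ ∣ → Subset (size G)) → ¬ 𝒢 (G [ W₀ ]) →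
          (∀ k → enum W₀ k ∉ W k) → (∀ k → Far r (W k)) → Far (suc r) (W₀ ∪ ⋃ᶠ W)
  far-∪ {r} {W₀} W W₀∉ vₖ∉Wₖ far X ∣X∣≤1+r with Fin.any? (λ k → enum W₀ k ∈? X)
  ... | no  avoids       = avoiding-∉ (p⊆p∪q _) (λ k vₖ∈X → avoids (k , vₖ∈X)) W₀∉
  ... | yes (k , vₖ∈X) = ∉-mono her G Wₖ─[X-vₖ]⊆W─X (far k (X - vₖ) ∣X-vₖ∣≤r)
    where
    vₖ : Fin (size G)
    vₖ = enum W₀ k
    ∣X-vₖ∣≤r : ∣ X - vₖ ∣ ≤ r
    ∣X-vₖ∣≤r = ≤-pred (≤-trans (x∈p⇒∣p-x∣<∣p∣ vₖ∈X) ∣X∣≤1+r)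
    Wₖ─[X-vₖ]⊆W─X : W k ─ (X - vₖ) ⊆ (W₀ ∪ ⋃ᶠ W) ─ X
    Wₖ─[X-vₖ]⊆W─X {x} x∈ = x∈p∧x∉q⇒x∈p─q (q⊆p∪q W₀ _ (fk⊆⋃ᶠf W k x∈Wₖ)) λ x∈X →
      x∈p─q⇒x∉q x∈ (x∈p∧x≢y⇒x∈p-y x∈X λ x≡vₖ → vₖ∉Wₖ k (subst (_∈ W k) x≡vₖ x∈Wₖ))
      where
      x∈Wₖ : x ∈ W k
      x∈Wₖ = p─q⊆p (W k) _ x∈

  module _ {N} (local : LocallyDetermined N 𝒢) where

    far-witness : ∀ r U → Far r U → ¬ ¬ ∃ λ W → W ⊆ U × ∣ W ∣ ≤ vertexApexBound N r × Far r W
    far-witness zero U far = do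
      (W₀ , W₀⊆U , ∣W₀∣≤N , W₀∉) ← witness-within her local G U (far⇒∉ far)
      pure (W₀ , (λ {x} → W₀⊆U {x}) , ∣W₀∣≤N , λ X ∣X∣≤0 →
        avoiding-∉ (λ {x} x∈ → x∈) (λ k x∈X → <⇒≱ (≤-<-trans z≤n (x∈p⇒∣p-x∣<∣p∣ x∈X)) ∣X∣≤0)
                   W₀∉)
    far-witness (suc r) U far = do
      (W₀ , W₀⊆U , ∣W₀∣≤N , W₀∉) ← witness-within her local G U (far⇒∉ far)
      Ws ← ∀¬¬⇒¬¬∀ λ k → far-witness r (U - enum W₀ k) (far-remove far (enum W₀ k))
      let W : Fin ∣ W₀ ∣ → Subset (size G)
          W k = proj₁ (Ws k)
          Wₖ⊆U-vₖ : ∀ k → W k ⊆ U - enum W₀ k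
          Wₖ⊆U-vₖ k = proj₁ (proj₂ (Ws k))
      pure ( W₀ ∪ ⋃ᶠ W
           , (λ {x} x∈ → [ W₀⊆U , ⋃ᶠ-least (λ k → p─q⊆p U _ ∘ Wₖ⊆U-vₖ k) ]′
                            (x∈p∪q⁻ W₀ (⋃ᶠ W) x∈))
           , ≤-trans (∣p∪q∣≤∣p∣+∣q∣ W₀ _) (+-mono-≤ ∣W₀∣≤N (≤-trans
               (∣⋃ᶠf∣≤m*N W λ k → proj₁ (proj₂ (proj₂ (Ws k))))
               (*-monoˡ-≤ (vertexApexBound N r) ∣W₀∣≤N)))
           , far-∪ W W₀∉ (λ k vₖ∈Wₖ → x∈p─q⇒x∉q (Wₖ⊆U-vₖ k vₖ∈Wₖ) (x∈⁅x⁆ (enum W₀ k)))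
                   (λ k → proj₂ (proj₂ (proj₂ (Ws k)))) )

vertexApex-locallyDetermined : ∀ {𝒢 N} → Hereditary 𝒢 → LocallyDetermined N 𝒢 → ∀ r →
                               LocallyDetermined (vertexApexBound N r) (VertexApex r 𝒢)
vertexApex-locallyDetermined her local r G G∉ = do
  (W , _ , ∣W∣≤ , far) ← far-witness her G local r ⊤ (¬vertexApex⇒far her G G∉)
  pure (W , ∣W∣≤ , far⇒¬vertexApex her G far)

corollary2p11 : (𝒢 : Class) → Hereditary 𝒢 → HasFiniteForbidden 𝒢 →
    (p q r : ℕ) →
    Hereditary (UnionClass p q r 𝒢) × HasFiniteForbidden (UnionClass p q r 𝒢)
corollary2p11 𝒢 her finite p q r = ∪-hereditary , locallyDetermined⇒hasFiniteForbidden ∪-local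
  where
  N : ℕ
  N = sizeBound (proj₁ finite)
  local : LocallyDetermined N 𝒢
  local = hasFiniteForbidden⇒locallyDetermined her finite
  add-hereditary : Hereditary (EdgeAdd p 𝒢)
  add-hereditary = edgeAdd-hereditary her p
  apex-hereditary : Hereditary (EdgeApex q 𝒢 ∪ᶜ VertexApex r 𝒢)
  apex-hereditary = ∪ᶜ-hereditary (edgeApex-hereditary her q) (vertexApex-hereditary her r)
  ∪-hereditary : Hereditary (EdgeAdd p 𝒢 ∪ᶜ (EdgeApex q 𝒢 ∪ᶜ VertexApex r 𝒢))
  ∪-hereditary = ∪ᶜ-hereditary add-hereditary apex-hereditary
  ∪-local : LocallyDetermined (edgeAddBound N p + (edgeAddBound N q + vertexApexBound N r))
                              (EdgeAdd p 𝒢 ∪ᶜ (EdgeApex q 𝒢 ∪ᶜ VertexApex r 𝒢))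
  ∪-local = ∪ᶜ-locallyDetermined add-hereditary apex-hereditary
              (edgeAdd-locallyDetermined her local p)
              (∪ᶜ-locallyDetermined (edgeApex-hereditary her q) (vertexApex-hereditary her r)
                 (edgeApex-locallyDetermined her local q) (vertexApex-locallyDetermined her local r))
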